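{- Let $(G,k,F,T,w)$ be an ELSS instance and let $v \in V(G) \setminus F$. Let $\mathfrak{X}$ be a set of descriptions for $G-v$ such that $\mathcal{T}_{G-v}(\mathfrak{X}) = \max_w(\mathcal{S}_{G-v}^{k-1}(F))$ and $v \in N_G(H)$ for all $H \in \mathcal{T}_{G-v}(\mathfrak{X})$. Then $$\mathcal{T}_G\big(\{(r, \mathcal{X} \cup \{\{v\}\}) \mid (r,\mathcal{X}) \in \mathfrak{X}\}\big) = \max_w \{H \in \mathcal{S}_G^{k}(F) \mid v \in N_G(H)\}.$$
   Context: Graphs are simple and undirected; $N_G(S)$ is the open neighborhood of $S\subseteq V(G)$, and for an induced subgraph $H$, $N_G(H) := N_G(V(H))$, $w(H) := \sum_{x \in V(H)} w(x)$. An induced subgraph $H$ is a $k$-secluded tree in $G$ if $H$ is a tree and $|N_G(H)| \le k$. An ELSS instance is a tuple $(G,k,F,T,w)$ with $G$ a graph, $k$ a non-negative integer, non-empty vertex sets $T \subseteq F \subseteq V(G)$ with $G[T]$ connected, and $w \colon V(G) \to \mathbb{N}^+$ (for subgraphs of $G$ the same $w$ is used). $\mathcal{S}_G^{k}(F)$ is the set of all induced subgraphs $H$ of $G$ that are trees with $F \subseteq V(H)$ and $|N_G(H)|\le k$. For a set $Y$ of subgraphs, $\max_w(Y) := \{H \in Y : w(H) \ge w(H') \text{ for all } H' \in Y\}$. A description for a graph $G$ is a pair $(r,\mathcal{X})$ with $r \in V(G)$ and $\mathcal{X}$ a set of pairwise disjoint subsets of $V(G)\setminus\{r\}$ such that for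 every set $S$ containing exactly one vertex from each $X \in \mathcal{X}$, the component $H$ of $G-S$ containing $r$ is acyclic and $N_G(H)=S$; its order is $|\mathcal{X}|$. A $k$-secluded tree $H$ is described by $(r,\mathcal{X})$ if $r\in V(H)$ and $N_G(H)$ consists of exactly one vertex of each $X\in\mathcal{X}$. For a set $\mathfrak{X}$ of descriptions of maximum order $k$, $\mathcal{T}_G(\mathfrak{X})$ is the set of $k$-secluded trees in $G$ described by some description in $\mathfrak{X}$. -}

module Defs where

open import Data.Bool using (Bool; true; false; _∧_; _∨_; not; if_then_else_; T)
open import Data.Nat using (ℕ; zero; suc; _+_; _≤_)
open import Data.Integer as ℤ using (ℤ; +_)
open import Data.Fin using (Fin; zero; suc)
open import Data.Vec as Vec using (Vec; []; _∷_; tabulate; lookup)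
open import Data.Fin.Subset using (Subset; _∈_; _∉_; _⊆_; _∩_; ∣_∣)
open import Data.List as List using (List; []; _∷_; length)
open import Data.List.Relation.Unary.All using (All)
open import Data.List.Relation.Unary.Any using (Any)
open import Data.List.Relation.Unary.AllPairs using (AllPairs)
open import Data.List.Relation.Unary.Unique.Propositional using (Unique)
open import Data.Product using (Σ; ∃; _×_; _,_)
open import Data.Unit using (⊤)
open import Data.Empty using (⊥)
open import Relation.Nullary using (¬_)
open import Relation.Binary.PropositionalEquality using (_≡_)

record Graph (n : ℕ) : Set where
  field
    adj    : Fin n → Fin n → Bool
    sym    : ∀ x y → adj x y ≡ adj y x
    irrefl : ∀ x → adj x x ≡ false
open Graph public

-- Convention: a graph "in context" is the induced subgraph of G on a vertex
-- set U : Subset n.  G itself is U = Data.Fin.Subset.⊤, and G - v is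
-- U = ∁ ⁅ v ⁆.  Induced subgraphs H of (G on U) are subsets H ⊆ U.

anyᶠ : ∀ {n} → (Fin n → Bool) → Bool
anyᶠ {zero}  f = false
anyᶠ {suc n} f = f zero ∨ anyᶠ (λ i → f (suc i))

module _ {n : ℕ} (G : Graph n) where

  nbhd : Subset n → Subset n → Subset n
  nbhd U H = tabulate λ x →
    lookup U x ∧ not (lookup H x) ∧ anyᶠ (λ y → lookup H y ∧ adj G y x)

  data Walk (H : Subset n) : Fin n → Fin n → Set where
    here : ∀ {x} → x ∈ H → Walk H x x
    step : ∀ {x y z} → x ∈ H → T (adj G x y) → Walk H y z → Walk H x z

  Connected : Subset n → Set
  Connected H = ∀ x y → x ∈ H → y ∈ H → Walk H x y

  Consec : List (Fin n) → Set
  Consec []           = ⊤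
  Consec (x ∷ [])     = ⊤
  Consec (x ∷ y ∷ zs) = T (adj G x y) × Consec (y ∷ zs)

  lastOr : Fin n → List (Fin n) → Fin n
  lastOr x []       = x
  lastOr x (y ∷ ys) = lastOr y ys

  Cycle : Subset n → Set
  Cycle H = Σ (Fin n) λ x → Σ (List (Fin n)) λ ys →
    (2 ≤ length ys) × Unique (x ∷ ys) × All (_∈ H) (x ∷ ys) ×
    Consec (x ∷ ys) × T (adj G (lastOr x ys) x)

  Acyclic : Subset n → Set
  Acyclic H = ¬ Cycle H

  IsTree : Subset n → Set
  IsTree H = (∃ λ x → x ∈ H) × Connected H × Acyclic H

  weight : (Fin n → ℕ) → Subset n → ℕ
  weight w H = Vec.sum (tabulate λ x → if lookup H x then w x else 0)

  -- S^k_{G[U]}(F), with integer bound k (so that k - 1 makes sense for k = 0)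
  S : (U : Subset n) → ℤ → Subset n → Subset n → Set
  S U k F H = H ⊆ U × IsTree H × F ⊆ H × (+ ∣ nbhd U H ∣) ℤ.≤ k

  MaxW : (Fin n → ℕ) → (Subset n → Set) → Subset n → Set
  MaxW w Y H = Y H × (∀ H' → Y H' → weight w H' ≤ weight w H)

  record Description : Set where
    constructor desc
    field
      root : Fin n
      parts : List (Subset n)
  open Description public

  OnePerPart : List (Subset n) → Subset n → Set
  OnePerPart 𝒳 S' = (∀ x → x ∈ S' → Any (x ∈_) 𝒳) × All (λ X → ∣ S' ∩ X ∣ ≡ 1) 𝒳

  IsComponent : (U S' : Subset n) → Fin n → Subset n → Set
  IsComponent U S' r H =
    (∀ x → x ∈ H → x ∈ U × x ∉ S') × r ∈ H × Connected H ×
    (∀ x y → x ∈ H → y ∈ U → y ∉ S' → T (adj G x y) → y ∈ H)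

  Disjoint : Subset n → Subset n → Set
  Disjoint X Y = ∀ x → x ∈ X → x ∉ Y

  IsDescription : Subset n → Description → Set
  IsDescription U (desc r 𝒳) =
    r ∈ U × All (λ X → X ⊆ U × r ∉ X) 𝒳 × AllPairs Disjoint 𝒳 ×
    (∀ S' → OnePerPart 𝒳 S' → ∀ H → IsComponent U S' r H →
      Acyclic H × nbhd U H ≡ S')

  DescribedBy : Subset n → Description → Subset n → Set
  DescribedBy U (desc r 𝒳) H = r ∈ H × OnePerPart 𝒳 (nbhd U H)

  𝒯 : Subset n → (Description → Set) → Subset n → Set
  𝒯 U 𝔛 H = H ⊆ U × IsTree H × ∃ λ d → 𝔛 d × DescribedBy U d H

  extendDescs : Fin n → (Description → Set) → Description → Set
  extendDescs v 𝔛 d' = ∃ λ d → 𝔛 d × d' ≡ desc (root d) (Data.Fin.Subset.⁅ v ⁆ ∷ parts d)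

  record IsELSS (k : ℕ) (F Tm : Subset n) (w : Fin n → ℕ) : Set where
    field
      F-nonempty : ∃ λ x → x ∈ F
      T-nonempty : ∃ λ x → x ∈ Tm
      T⊆F        : Tm ⊆ F
      T-conn     : Connected Tm
      w-pos      : ∀ x → 1 ≤ w x

-- If v ∈ N_G(H), then v ∉ H and N_{G-v}(H) = N_G(H) ∖ {v}; hence H ∈ S^k_G(F) iff
-- H ∈ S^{k-1}_{G-v}(F), and (r, 𝒳 ∪ {{v}}) describes H in G iff (r, 𝒳) describes it in G - v.
-- So both sides arise from S^{k-1}_{G-v}(F) by demanding v ∈ N_G(H), and as every
-- maximum-weight member of S^{k-1}_{G-v}(F) already meets this demand, the maxima survive.
module Submission where

open import Defs
open import Data.Nat using (ℕ)
open import Data.Integer using (+_; _-_; 1ℤ)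
open import Data.Fin using (Fin)
open import Data.Fin.Subset using (Subset; _∈_; _∉_; ∁; ⁅_⁆; ⊤)
open import Data.Product using (_×_)
open import Function.Bundles using (_⇔_)

open import Level using (Level; _⊔_)
open import Data.Bool using (Bool; true; false; _∧_; not; if_then_else_)
open import Data.Bool.Properties using (∧-zeroʳ)
open import Data.Nat as ℕ using (suc; _≤_; _<_; _∸_; z≤n; s≤s; _≤?_)
open import Data.Nat.Properties using (≤-refl; +-mono-≤; <-trans; <⇒≱; ≰⇒>; ∸-monoʳ-<)
open import Data.Nat.Induction using (<-wellFounded)
import Data.Integer as ℤ
open import Data.Fin using (zero; suc; _≟_)
open import Data.Fin.Subset using (⊥; _⊆_; _∩_; ∣_∣; inside; outside)
open import Data.Fin.Subset.Properties
  using (_∈?_; ∈⊤; x∈⁅x⁆; x∈⁅y⁆⇒x≡y; x≢y⇒x∉⁅y⁆; ∣⁅x⁆∣≡1; ∣⊥∣≡0; Empty-unique;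
         ⊆-antisym; p∩q⊆q; x∈p∩q⁺; x∈p∩q⁻; x∉p⇒x∈∁p; x∈∁p⇒x∉p)
open import Data.Vec as Vec using ([]; _∷_; lookup; tabulate)
open import Data.Vec.Properties
  using ([]=⇒lookup; lookup-zipWith; lookup∘tabulate; tabulate∘lookup; tabulate-cong; lookup-replicate)
open import Data.List using (_∷_)
open import Data.List.Relation.Unary.All as All using (All; _∷_)
open import Data.List.Relation.Unary.Any using (Any; here; there)
open import Data.Product using (_,_; proj₁; proj₂)
open import Function.Base using (_∘_)
open import Function.Bundles using (mk⇔; Equivalence)
open import Function.Construct.Symmetry using (⇔-sym)
open import Function.Related.Propositional using (module EquationalReasoning)
open import Induction.WellFounded using (Acc; acc)
open import Relation.Nullary using (yes; no; contradiction)
open import Relation.Binary.PropositionalEquality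
  using (_≡_; refl; trans; cong; subst; module ≡-Reasoning) renaming (sym to ≡-sym)

private
  variable
    a ℓ ℓ′ : Level

module _ {A : Set a} (W : A → ℕ) where

  IsMaximum : (A → Set ℓ) → A → Set (a ⊔ ℓ)
  IsMaximum P x = P x × (∀ y → P y → W y ≤ W x)

  IsMaximum-cong : {P Q : A → Set ℓ} → (∀ x → P x ⇔ Q x) → ∀ x → IsMaximum P x ⇔ IsMaximum Q x
  IsMaximum-cong P⇔Q x = mk⇔
    (λ (Px , max) → to (P⇔Q x) Px , λ y → max y ∘ from (P⇔Q y))
    (λ (Qx , max) → from (P⇔Q x) Qx , λ y → max y ∘ to (P⇔Q y))
    where open Equivalence

  module _ {B : ℕ} (W≤B : ∀ x → W x ≤ B) {P : A → Set ℓ} where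

    -- No maximum need be exhibited: an element heavier than m would itself be a maximum,
    -- since by induction on B ∸ W every heavier element of P weighs at most m.
    maxima-bound⇒bound : ∀ {m} → (∀ x → IsMaximum P x → W x ≤ m) → ∀ x → P x → W x ≤ m
    maxima-bound⇒bound {m} maxima≤m x Px = go x (<-wellFounded (B ∸ W x)) Px
      where
      go : ∀ x → Acc _<_ (B ∸ W x) → P x → W x ≤ m
      go x (acc rec) Px with W x ≤? m
      ... | yes x≤m = x≤m
      ... | no  x≰m = contradiction (maxima≤m x (Px , x-dominates)) x≰m
        where
        x-dominates : ∀ y → P y → W y ≤ W x
        x-dominates y Py with W y ≤? W x
        ... | yes y≤x = y≤x
        ... | no  y≰x = contradiction
          (go y (rec (∸-monoʳ-< (≰⇒> y≰x) (W≤B y))) Py)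
          (<⇒≱ (<-trans (≰⇒> x≰m) (≰⇒> y≰x)))

    IsMaximum-restrict : {R : A → Set ℓ′} → (∀ x → IsMaximum P x → R x) →
                         ∀ x → IsMaximum (λ y → P y × R y) x ⇔ IsMaximum P x
    IsMaximum-restrict maxima∈R x = mk⇔
      (λ ((Px , _) , max) → Px , maxima-bound⇒bound (λ y ymax → max y (proj₁ ymax , maxima∈R y ymax)))
      (λ xmax@(Px , max) → (Px , maxima∈R x xmax) , λ y → max y ∘ proj₁)

sum-tabulate-mono : ∀ {n} {f g : Fin n → ℕ} → (∀ i → f i ≤ g i) →
                    Vec.sum (tabulate f) ≤ Vec.sum (tabulate g)
sum-tabulate-mono {ℕ.zero} f≤g = z≤n
sum-tabulate-mono {suc n}  f≤g = +-mono-≤ (f≤g zero) (sum-tabulate-mono (f≤g ∘ suc))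

∁⊥∩p≡p : ∀ {n} (p : Subset n) → ∁ ⊥ ∩ p ≡ p
∁⊥∩p≡p []      = refl
∁⊥∩p≡p (s ∷ p) = cong (s ∷_) (∁⊥∩p≡p p)

∣p∣≡1+∣∁⁅x⁆∩p∣ : ∀ {n} {x : Fin n} {p : Subset n} → x ∈ p → ∣ p ∣ ≡ suc ∣ ∁ ⁅ x ⁆ ∩ p ∣
∣p∣≡1+∣∁⁅x⁆∩p∣ {p = inside  ∷ p} Vec.here         = cong (suc ∘ ∣_∣) (≡-sym (∁⊥∩p≡p p))
∣p∣≡1+∣∁⁅x⁆∩p∣ {p = inside  ∷ p} (Vec.there x∈p) = cong suc (∣p∣≡1+∣∁⁅x⁆∩p∣ x∈p)
∣p∣≡1+∣∁⁅x⁆∩p∣ {p = outside ∷ p} (Vec.there x∈p) = ∣p∣≡1+∣∁⁅x⁆∩p∣ x∈p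

∣p∩⁅x⁆∣≡1⇔x∈p : ∀ {n} {x : Fin n} {p : Subset n} → ∣ p ∩ ⁅ x ⁆ ∣ ≡ 1 ⇔ x ∈ p
∣p∩⁅x⁆∣≡1⇔x∈p {n} {x} {p} = mk⇔ one⇒∈ ∈⇒one
  where
  ∈⇒one : x ∈ p → ∣ p ∩ ⁅ x ⁆ ∣ ≡ 1
  ∈⇒one x∈p = trans (cong ∣_∣ (⊆-antisym (p∩q⊆q p ⁅ x ⁆) ⁅x⁆⊆p∩⁅x⁆)) (∣⁅x⁆∣≡1 x)
    where
    ⁅x⁆⊆p∩⁅x⁆ : ⁅ x ⁆ ⊆ p ∩ ⁅ x ⁆
    ⁅x⁆⊆p∩⁅x⁆ y∈⁅x⁆ = x∈p∩q⁺ (subst (_∈ p) (≡-sym (x∈⁅y⁆⇒x≡y x y∈⁅x⁆)) x∈p , y∈⁅x⁆)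

  one⇒∈ : ∣ p ∩ ⁅ x ⁆ ∣ ≡ 1 → x ∈ p
  one⇒∈ one with x ∈? p
  ... | yes x∈p = x∈p
  ... | no  x∉p = contradiction (trans (≡-sym (∣⊥∣≡0 n)) (trans (cong ∣_∣ (≡-sym p∩⁅x⁆≡⊥)) one)) λ ()
    where
    p∩⁅x⁆≡⊥ : p ∩ ⁅ x ⁆ ≡ ⊥
    p∩⁅x⁆≡⊥ = Empty-unique λ (y , y∈) → let y∈p , y∈⁅x⁆ = x∈p∩q⁻ p ⁅ x ⁆ y∈ in
      x∉p (subst (_∈ p) (x∈⁅y⁆⇒x≡y x y∈⁅x⁆) y∈p)

q⊆r⇒[r∩p]∩q≡p∩q : ∀ {n} {q r : Subset n} (p : Subset n) → q ⊆ r → (r ∩ p) ∩ q ≡ p ∩ q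
q⊆r⇒[r∩p]∩q≡p∩q {q = q} {r} p q⊆r = ⊆-antisym
  (λ x∈ → let x∈r∩p , x∈q = x∈p∩q⁻ (r ∩ p) q x∈ in x∈p∩q⁺ (proj₂ (x∈p∩q⁻ r p x∈r∩p) , x∈q))
  (λ x∈ → let x∈p , x∈q = x∈p∩q⁻ p q x∈ in x∈p∩q⁺ (x∈p∩q⁺ (q⊆r x∈q , x∈p) , x∈q))

∉⇒⊆∁⁅⁆ : ∀ {n} {x : Fin n} {p : Subset n} → x ∉ p → p ⊆ ∁ ⁅ x ⁆
∉⇒⊆∁⁅⁆ {x = x} {p} x∉p y∈p = x∉p⇒x∈∁p λ y∈⁅x⁆ → x∉p (subst (_∈ p) (x∈⁅y⁆⇒x≡y x y∈⁅x⁆) y∈p)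

+≤+-1⇔+suc≤+ : ∀ {m k} → + m ℤ.≤ + k - 1ℤ ⇔ + suc m ℤ.≤ + k
+≤+-1⇔+suc≤+ = mk⇔ to from
  where
  to : ∀ {m k} → + m ℤ.≤ + k - 1ℤ → + suc m ℤ.≤ + k
  to {k = suc k} (ℤ.+≤+ m≤k) = ℤ.+≤+ (s≤s m≤k)
  from : ∀ {m k} → + suc m ℤ.≤ + k → + m ℤ.≤ + k - 1ℤ
  from {k = suc k} (ℤ.+≤+ (s≤s m≤k)) = ℤ.+≤+ m≤k

module _ {n : ℕ} (G : Graph n) where

  weight≤total : (w : Fin n → ℕ) (H : Subset n) → weight G w H ≤ Vec.sum (tabulate w)
  weight≤total w H = sum-tabulate-mono λ x → if≤ (lookup H x) (w x)
    where
    if≤ : ∀ b m → (if b then m else 0) ≤ m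
    if≤ true  m = ≤-refl
    if≤ false m = z≤n

  nbhd-∩ : ∀ U H → nbhd G U H ≡ U ∩ nbhd G ⊤ H
  nbhd-∩ U H = begin
    nbhd G U H
      ≡⟨ tabulate-cong (cong (lookup U _ ∧_) ∘ ≡-sym ∘ lookup-nbhd-⊤) ⟩
    tabulate (λ x → lookup U x ∧ lookup (nbhd G ⊤ H) x)
      ≡⟨ tabulate-cong (λ x → ≡-sym (lookup-zipWith _∧_ x U (nbhd G ⊤ H))) ⟩
    tabulate (lookup (U ∩ nbhd G ⊤ H))
      ≡⟨ tabulate∘lookup (U ∩ nbhd G ⊤ H) ⟩
    U ∩ nbhd G ⊤ H
      ∎
    where
    open ≡-Reasoning
    outside-H-adjacent-to-H : Fin n → Bool
    outside-H-adjacent-to-H x = not (lookup H x) ∧ anyᶠ (λ y → lookup H y ∧ adj G y x)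
    lookup-nbhd-⊤ : ∀ x → lookup (nbhd G ⊤ H) x ≡ outside-H-adjacent-to-H x
    lookup-nbhd-⊤ x =
      trans (lookup∘tabulate _ x) (cong (_∧ outside-H-adjacent-to-H x) (lookup-replicate x true))

  ∈nbhd⇒∉ : ∀ U H {x} → x ∈ nbhd G U H → x ∉ H
  ∈nbhd⇒∉ U H {x} x∈N x∈H
    with lookup H x | []=⇒lookup x∈H | trans (≡-sym (lookup∘tabulate _ x)) ([]=⇒lookup x∈N)
  ... | .true | refl | x∈N′ = contradiction (trans (≡-sym (∧-zeroʳ (lookup U x))) x∈N′) λ ()

  module _ (v : Fin n) where

    ∣nbhd∣≡1+∣nbhd-v∣ : ∀ H → v ∈ nbhd G ⊤ H → ∣ nbhd G ⊤ H ∣ ≡ suc ∣ nbhd G (∁ ⁅ v ⁆) H ∣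
    ∣nbhd∣≡1+∣nbhd-v∣ H v∈N =
      trans (∣p∣≡1+∣∁⁅x⁆∩p∣ v∈N) (cong (suc ∘ ∣_∣) (≡-sym (nbhd-∩ (∁ ⁅ v ⁆) H)))

    S-delete : ∀ k F H → (S G ⊤ (+ k) F H × v ∈ nbhd G ⊤ H)
                       ⇔ (S G (∁ ⁅ v ⁆) (+ k - 1ℤ) F H × v ∈ nbhd G ⊤ H)
    S-delete k F H = mk⇔
      (λ ((_ , tree , F⊆H , N≤k) , v∈N) →
        (∉⇒⊆∁⁅⁆ (∈nbhd⇒∉ ⊤ H v∈N) , tree , F⊆H ,
         from +≤+-1⇔+suc≤+ (subst ≤k (∣nbhd∣≡1+∣nbhd-v∣ H v∈N) N≤k)) , v∈N)
      (λ ((_ , tree , F⊆H , N-v≤k-1) , v∈N) →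
        ((λ _ → ∈⊤) , tree , F⊆H ,
         subst ≤k (≡-sym (∣nbhd∣≡1+∣nbhd-v∣ H v∈N)) (to +≤+-1⇔+suc≤+ N-v≤k-1)) , v∈N)
      where
      open Equivalence
      ≤k : ℕ → Set
      ≤k c = + c ℤ.≤ + k

    OnePerPart-⁅⁆∷ : ∀ {𝒳 S′} → All (_⊆ ∁ ⁅ v ⁆) 𝒳 →
                     OnePerPart G (⁅ v ⁆ ∷ 𝒳) S′ ⇔ (v ∈ S′ × OnePerPart G 𝒳 (∁ ⁅ v ⁆ ∩ S′))
    OnePerPart-⁅⁆∷ {𝒳} {S′} 𝒳⊆∁⁅v⁆ = mk⇔
      (λ { (covers , one ∷ ones) →
        Equivalence.to ∣p∩⁅x⁆∣≡1⇔x∈p one , covers-v covers ,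
        All.zipWith {P = _⊆ ∁ ⁅ v ⁆} (λ (X⊆ , one) → trans (restrict X⊆) one) (𝒳⊆∁⁅v⁆ , ones) })
      (λ (v∈S′ , covers , ones) →
        covers+v covers , Equivalence.from ∣p∩⁅x⁆∣≡1⇔x∈p v∈S′ ∷
        All.zipWith {P = _⊆ ∁ ⁅ v ⁆} (λ (X⊆ , one) → trans (≡-sym (restrict X⊆)) one) (𝒳⊆∁⁅v⁆ , ones))
      where
      restrict : ∀ {X} → X ⊆ ∁ ⁅ v ⁆ → ∣ (∁ ⁅ v ⁆ ∩ S′) ∩ X ∣ ≡ ∣ S′ ∩ X ∣
      restrict X⊆ = cong ∣_∣ (q⊆r⇒[r∩p]∩q≡p∩q S′ X⊆)
      covers-v : (∀ x → x ∈ S′ → Any (x ∈_) (⁅ v ⁆ ∷ 𝒳)) → ∀ x → x ∈ ∁ ⁅ v ⁆ ∩ S′ → Any (x ∈_) 𝒳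
      covers-v covers x x∈ with x∈p∩q⁻ (∁ ⁅ v ⁆) S′ x∈
      ... | x∈∁⁅v⁆ , x∈S′ with covers x x∈S′
      ...   | here  x∈⁅v⁆ = contradiction x∈⁅v⁆ (x∈∁p⇒x∉p x∈∁⁅v⁆)
      ...   | there x∈𝒳   = x∈𝒳
      covers+v : (∀ x → x ∈ ∁ ⁅ v ⁆ ∩ S′ → Any (x ∈_) 𝒳) → ∀ x → x ∈ S′ → Any (x ∈_) (⁅ v ⁆ ∷ 𝒳)
      covers+v covers x x∈S′ with x ≟ v
      ... | yes refl = here (x∈⁅x⁆ x)
      ... | no  x≢v  = there (covers x (x∈p∩q⁺ (x∉p⇒x∈∁p (x≢y⇒x∉⁅y⁆ x≢v) , x∈S′)))

    𝒯-extend : {𝔛 : Description G → Set} → (∀ d → 𝔛 d → All (_⊆ ∁ ⁅ v ⁆) (parts d)) → ∀ H →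
               𝒯 G ⊤ (extendDescs G v 𝔛) H ⇔ (𝒯 G (∁ ⁅ v ⁆) 𝔛 H × v ∈ nbhd G ⊤ H)
    𝒯-extend {𝔛} parts⊆ H = mk⇔
      (λ { (_ , tree , ._ , (desc r 𝒳 , d∈𝔛 , refl) , r∈H , one) →
           let v∈N , one-v = Equivalence.to (OnePerPart-⁅⁆∷ (parts⊆ (desc r 𝒳) d∈𝔛)) one in
           (∉⇒⊆∁⁅⁆ (∈nbhd⇒∉ ⊤ H v∈N) , tree , desc r 𝒳 , d∈𝔛 , r∈H , subst (OnePerPart G 𝒳) ∩nbhd≡nbhd one-v)
           , v∈N })
      (λ { ((_ , tree , desc r 𝒳 , d∈𝔛 , r∈H , one-v) , v∈N) →
           (λ _ → ∈⊤) , tree , desc r (⁅ v ⁆ ∷ 𝒳) , (desc r 𝒳 , d∈𝔛 , refl) , r∈H ,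
           Equivalence.from (OnePerPart-⁅⁆∷ (parts⊆ (desc r 𝒳) d∈𝔛))
             (v∈N , subst (OnePerPart G 𝒳) (≡-sym ∩nbhd≡nbhd) one-v) })
      where
      ∩nbhd≡nbhd : ∁ ⁅ v ⁆ ∩ nbhd G ⊤ H ≡ nbhd G (∁ ⁅ v ⁆) H
      ∩nbhd≡nbhd = ≡-sym (nbhd-∩ (∁ ⁅ v ⁆) H)

lemma3 : ∀ {n} (G : Graph n) (k : ℕ) (F Tm : Subset n) (w : Fin n → ℕ) →
  IsELSS G k F Tm w → (v : Fin n) → v ∉ F →
  (𝔛 : Description G → Set) →
  (∀ d → 𝔛 d → IsDescription G (∁ ⁅ v ⁆) d) →
  (∀ H → 𝒯 G (∁ ⁅ v ⁆) 𝔛 H ⇔ MaxW G w (S G (∁ ⁅ v ⁆) (+ k - 1ℤ) F) H) →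
  (∀ H → 𝒯 G (∁ ⁅ v ⁆) 𝔛 H → v ∈ nbhd G ⊤ H) →
  ∀ H → 𝒯 G ⊤ (extendDescs G v 𝔛) H
        ⇔ MaxW G w (λ H' → S G ⊤ (+ k) F H' × v ∈ nbhd G ⊤ H') H
lemma3 G k F Tm w _ v _ 𝔛 isDesc 𝒯⇔max 𝒯⇒v∈N H = begin
  𝒯 G ⊤ (extendDescs G v 𝔛) H
    ∼⟨ 𝒯-extend G v parts⊆ H ⟩
  (𝒯 G (∁ ⁅ v ⁆) 𝔛 H × v ∈ nbhd G ⊤ H)
    ∼⟨ mk⇔ proj₁ (λ t → t , 𝒯⇒v∈N H t) ⟩
  𝒯 G (∁ ⁅ v ⁆) 𝔛 H
    ∼⟨ 𝒯⇔max H ⟩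
  MaxW G w S-v H
    ∼⟨ ⇔-sym (IsMaximum-restrict W (weight≤total G w) maxima⇒v∈N H) ⟩
  IsMaximum W (λ H′ → S-v H′ × v ∈ nbhd G ⊤ H′) H
    ∼⟨ IsMaximum-cong W (⇔-sym ∘ S-delete G v k F) H ⟩
  MaxW G w (λ H′ → S G ⊤ (+ k) F H′ × v ∈ nbhd G ⊤ H′) H
    ∎
  where
  open EquationalReasoning
  W : Subset _ → ℕ
  W = weight G w
  S-v : Subset _ → Set
  S-v = S G (∁ ⁅ v ⁆) (+ k - 1ℤ) F
  parts⊆ : ∀ d → 𝔛 d → All (_⊆ ∁ ⁅ v ⁆) (parts d)
  parts⊆ (desc r 𝒳) d∈𝔛 = All.map proj₁ (proj₁ (proj₂ (isDesc (desc r 𝒳) d∈𝔛)))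
  maxima⇒v∈N : ∀ H′ → MaxW G w S-v H′ → v ∈ nbhd G ⊤ H′
  maxima⇒v∈N H′ = 𝒯⇒v∈N H′ ∘ Equivalence.from (𝒯⇔max H′)
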